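{- Let $a\ge 2$, $\ell \ge 1$, $n=a+\ell-1$, $\mu=(a,1^{\ell-1})$, $\rho=(a-1,1^\ell)$. Let $SF_<(\mu)=\{S \in SF(\mu): S_{1,1}<S_{1,a}\}$ and $SF_<(\rho)=\{T\in SF(\rho): T_{\ell+1,1}<T_{1,1}\}$. Then the map $\theta: SF_<(\mu)\to SF_<(\rho)$ defined below satisfies $\varphi_S=\varphi_{\theta(S)}$ for every $S\in SF_<(\mu)$. Definition of $\theta$: for $S\in SF_<(\mu)$, let $u=S_{1,1}$ and let $v$ be the leftmost entry of the first row of $S$ that is $>u$. Let $\theta(S)$ be the filling of $\rho$ whose first row (read left to right, $a-1$ cells, including the corner cell $(1,1)$) is $\mathsf{arm}_u(S_{1,2}S_{1,3}\cdots S_{1,a})$, and whose first column strictly above row $1$ (the $\ell$ cells $(2,1),\dots,(\ell+1,1)$, read bottom to top) is $\mathsf{leg}_v(S_{1,1}S_{2,1}\cdots S_{\ell,1})$.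
   Context: Fillings use French convention (row $1$ is the bottom row); $S_{i,j}$ is the entry in row $i$, column $j$. For a hook $\nu\vdash n$, $SF(\nu)$ is the set of standard fillings (bijections from cells of $\nu$ to $\{1,\dots,n\}$). A row inversion of $S$ is a pair $(t,r)$ of entries of row $1$ with $t$ left of $r$ and $t>r$; a column inversion is a pair $(d,c)$ of entries of column $1$ with $d$ above $c$ and $d>c$. Define the monomial $\varphi_S=\prod_{(d,c)\text{ col. inv.}}x_d\prod_{(t,r)\text{ row inv.}}y_r\in\mathbb{Q}[x_1,\dots,x_n,y_1,\dots,y_n]$. Map $\mathsf{arm}_u$: for $u\in\mathbb{N}$, it is defined on words $w=w_1\cdots w_m$ of positive integers with all letters $\neq u$ and $w_m>u$. Let $b_1<\dots<b_j$ be the indices with $w_{b_i}<u$; if there are none, $\mathsf{arm}_u(w)=w$. Otherwise: (1) draw a vertical bar immediately to the left of $w_{b_i}$ whenever $w_{b_i-1}>u$, or when $i=1$ and $b_1=1$; (2) in each resulting block (maximal segment between bars, or after the last bar) containing at least one letter $<u$, move the leftmost letter $>u$ of that block to the front of the block. The resulting word is $\mathsf{arm}_u(w)$. (E.g. $\mathsf{arm}_5(49263187)=94628317$.) Map $\mathsf{leg}_v$: for $v\in\mathbb{N}$, it is defined on words $w=w_1\cdots w_m$ with all letters $\neq v$ and $w_1<v$. Let $c_1<\dots<c_k$ be the indices with $w_{c_i}>v$; if there are none, $\mathsf{leg}_v(w)=w$. Otherwise: (1) draw a vertical bar immediately to the right of $w_{c_i}$ whenever $w_{c_i+1}<v$,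 or when $i=k$ and $c_k=m$; (2) in each resulting block (segment before the first bar or between consecutive bars) containing at least one letter $>v$, move the rightmost letter $<v$ of that block to the end of the block. The resulting word is $\mathsf{leg}_v(w)$. (E.g. $\mathsf{leg}_5(48731926)=87439162$.) -}

module Defs where

open import Data.Nat using (ℕ; zero; suc; _+_; _∸_; _<_; _≤_; _<ᵇ_; _≡ᵇ_)
open import Data.Bool using (Bool; true; false; _∧_; _∨_; if_then_else_; not)
open import Data.List using (List; []; _∷_; _++_; [_]; reverse; length; map; upTo; take; drop)
open import Data.Maybe using (Maybe; just; nothing)
open import Data.Product using (_×_; _,_)
open import Relation.Binary.PropositionalEquality using (_≡_)
open import Data.List.Relation.Binary.Permutation.Propositional using (_↭_)

-- A filling of the hook (p, 1^q) (French convention) is given by two lists: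
--   row    = S_{1,1} S_{1,2} ... S_{1,p}        (row 1, left to right)
--   colUp  = S_{2,1} S_{3,1} ... S_{q+1,1}      (column 1 strictly above row 1,
--                                                read bottom to top)
-- Column 1 read bottom to top is then  take 1 row ++ colUp.

oneTo : ℕ → List ℕ
oneTo n = map suc (upTo n)

IsStdHook : ℕ → ℕ → List ℕ → List ℕ → Set
IsStdHook p q row colUp =
  (length row ≡ p) × (length colUp ≡ q) × ((row ++ colUp) ↭ oneTo (p + q))

-- first / last entries of a list (default 0, only used on nonempty lists)
headD : List ℕ → ℕ
headD []      = 0
headD (x ∷ _) = x

lastD : List ℕ → ℕ
lastD []           = 0
lastD (x ∷ [])     = x
lastD (_ ∷ y ∷ ys) = lastD (y ∷ ys)

column1 : List ℕ → List ℕ → List ℕ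
column1 row colUp = take 1 row ++ colUp

orderedPairs : {A : Set} → List A → List (A × A)
orderedPairs []       = []
orderedPairs (x ∷ xs) = map (λ y → (x , y)) xs ++ orderedPairs xs

selCol : List (ℕ × ℕ) → List (ℕ × ℕ)
selCol [] = []
selCol ((c , d) ∷ ps) = if c <ᵇ d then (d , c) ∷ selCol ps else selCol ps

selRow : List (ℕ × ℕ) → List (ℕ × ℕ)
selRow [] = []
selRow ((t , r) ∷ ps) = if r <ᵇ t then (t , r) ∷ selRow ps else selRow ps

colInversions : List ℕ → List ℕ → List (ℕ × ℕ)
colInversions row colUp = selCol (orderedPairs (column1 row colUp))

rowInversions : List ℕ → List ℕ → List (ℕ × ℕ)
rowInversions row colUp = selRow (orderedPairs row)

countFst : ℕ → List (ℕ × ℕ) → ℕ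
countFst i [] = 0
countFst i ((a , b) ∷ ps) = if a ≡ᵇ i then suc (countFst i ps) else countFst i ps

countSnd : ℕ → List (ℕ × ℕ) → ℕ
countSnd i [] = 0
countSnd i ((a , b) ∷ ps) = if b ≡ᵇ i then suc (countSnd i ps) else countSnd i ps

-- A monomial in Q[x_1..x_n, y_1..y_n] (coefficient 1), given by its
-- exponent vectors: xExp i = exponent of x_i, yExp i = exponent of y_i.
record Monomial : Set where
  constructor mono
  field
    xExp : ℕ → ℕ
    yExp : ℕ → ℕ
open Monomial public

_≈ₘ_ : Monomial → Monomial → Set
m ≈ₘ m' = ∀ i → (xExp m i ≡ xExp m' i) × (yExp m i ≡ yExp m' i)

-- φ_S = ∏_{(d,c) col. inv.} x_d ∏_{(t,r) row inv.} y_r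
φ : List ℕ → List ℕ → Monomial
φ row colUp = mono (λ i → countFst i (colInversions row colUp))
                   (λ i → countSnd i (rowInversions row colUp))

-- flags: true = bar immediately LEFT of this letter; the first block is the
-- (possibly empty) segment before the first bar
splitBefore : List ℕ → List (Bool × ℕ) → List (List ℕ)
splitBefore acc [] = [ reverse acc ]
splitBefore acc ((true  , x) ∷ xs) = reverse acc ∷ splitBefore [ x ] xs
splitBefore acc ((false , x) ∷ xs) = splitBefore (x ∷ acc) xs

-- flags: true = bar immediately RIGHT of this letter; the last block is the
-- (possibly empty) segment after the last bar
splitAfter : List ℕ → List (Bool × ℕ) → List (List ℕ)
splitAfter acc [] = [ reverse acc ]
splitAfter acc ((true  , x) ∷ xs) = reverse (x ∷ acc) ∷ splitAfter [] xs
splitAfter acc ((false , x) ∷ xs) = splitAfter (x ∷ acc) xs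

concatL : List (List ℕ) → List ℕ
concatL [] = []
concatL (b ∷ bs) = b ++ concatL bs

anyᵇ : (ℕ → Bool) → List ℕ → Bool
anyᵇ p [] = false
anyᵇ p (x ∷ xs) = p x ∨ anyᵇ p xs

moveFirstToFront : (ℕ → Bool) → List ℕ → List ℕ
moveFirstToFront p [] = []
moveFirstToFront p (x ∷ xs) with p x
... | true  = x ∷ xs
... | false with moveFirstToFront p xs
...   | []     = x ∷ []
...   | y ∷ ys = if p y then y ∷ x ∷ ys else x ∷ y ∷ ys

moveLastToEnd : (ℕ → Bool) → List ℕ → List ℕ
moveLastToEnd p w = reverse (moveFirstToFront p (reverse w))

armFlags : ℕ → Maybe ℕ → List ℕ → List (Bool × ℕ)
armFlags u prev [] = []
armFlags u nothing  (x ∷ xs) = ((x <ᵇ u) , x) ∷ armFlags u (just x) xs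
armFlags u (just p) (x ∷ xs) = ((x <ᵇ u) ∧ (u <ᵇ p) , x) ∷ armFlags u (just x) xs

armBlock : ℕ → List ℕ → List ℕ
armBlock u blk =
  if anyᵇ (λ x → x <ᵇ u) blk then moveFirstToFront (λ x → u <ᵇ x) blk else blk

arm : ℕ → List ℕ → List ℕ
arm u w = concatL (map (armBlock u) (splitBefore [] (armFlags u nothing w)))

legFlags : ℕ → List ℕ → List (Bool × ℕ)
legFlags v [] = []
legFlags v (x ∷ []) = ((v <ᵇ x) , x) ∷ []
legFlags v (x ∷ y ∷ ys) = ((v <ᵇ x) ∧ (y <ᵇ v) , x) ∷ legFlags v (y ∷ ys)

legBlock : ℕ → List ℕ → List ℕ
legBlock v blk =
  if anyᵇ (λ x → v <ᵇ x) blk then moveLastToEnd (λ x → x <ᵇ v) blk else blk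

leg : ℕ → List ℕ → List ℕ
leg v w = concatL (map (legBlock v) (splitAfter [] (legFlags v w)))

firstAbove : ℕ → List ℕ → ℕ
firstAbove u [] = 0
firstAbove u (x ∷ xs) = if u <ᵇ x then x else firstAbove u xs

-- θ(S) for S = (row , colUp) a filling of μ = (a, 1^{ℓ-1}); the result is a
-- filling of ρ = (a-1, 1^ℓ), given as (row 1 , column 1 strictly above row 1)
θRow : List ℕ → List ℕ → List ℕ
θRow row colUp = arm (headD row) (drop 1 row)

θCol : List ℕ → List ℕ → List ℕ
θCol row colUp = leg (firstAbove (headD row) row) (take 1 row ++ colUp)

{-# OPTIONS --safe #-}
-- Both exponent vectors of φ are sums, over the pairs of letters of a word (row 1 for y,
-- column 1 for x), of a weight depending only on one letter and on how the two compare.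
-- The bars of arm_u cut w into blocks L G with L below u and G above u (plus an initial block
-- above u). Bringing the first letter g of G to the front of its block trades the row
-- inversions (u , l), l ∈ L, of u·w for the inversions (g , l) and leaves every other pair of
-- the block alone, while pairs from different blocks only see the blocks as multisets; so u·w
-- and arm_u(w) give the same y-exponents. Dually the bars of leg_v cut u·colUp into blocks
-- L l G with L, l below v and G above v, and moving l behind G trades the column inversions
-- (l , g) for the inversions (v , g) of v·leg_v(u·colUp), whose bottom letter v is indeed the
-- corner of θ(S), because arm_u(w) starts with the first letter of w above u.
module Submission where

open import Defs
open import Data.Nat using (ℕ; zero; suc; _≤_; _<_; _+_; _∸_; z≤n; s≤s; _<ᵇ_; _≡ᵇ_)
open import Data.Nat.Properties
  using (+-identityʳ; +-comm; <⇒≤; <-asym; <-irrefl; <-trans; <-cmp; ≤-refl; ≮⇒≥; _<?_; >⇒≢; ≤-<-trans; suc-injective; +-commutativeSemigroup)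
open import Data.Nat.ListAction using (sum)
open import Data.Nat.ListAction.Properties using (sum-++; sum-↭)
open import Data.Nat.Tactic.RingSolver using (solve-∀)
open import Algebra.Properties.CommutativeSemigroup +-commutativeSemigroup using (interchange)
open import Data.Bool using (Bool; true; false; if_then_else_)
open import Data.Bool.Properties using (∨-zeroʳ)
open import Data.List using (List; []; _∷_; _++_; [_]; reverse; map; take)
open import Data.List.Properties
  using (map-++; map-cong; map-cong-local; map-∘; ++-assoc; ++-identityʳ; reverse-++; reverse-involutive; unfold-reverse; ∷ʳ-++; ʳ++-defn; ++-conicalʳ)
open import Data.List.Relation.Unary.All as All using (All; []; _∷_)
open import Data.List.Relation.Unary.All.Properties using (++⁻ˡ; ++⁻ʳ)
open import Data.List.Relation.Unary.Any using (Any; here; there)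
open import Data.List.Relation.Unary.Any.Properties using (++⁺ʳ)
open import Data.List.Membership.Propositional using (_∈_; lose)
open import Data.List.Relation.Unary.Unique.Propositional using (Unique; _∷_)
open import Data.List.Relation.Unary.Unique.Propositional.Properties as Unique using (upTo⁺)
open import Data.List.Relation.Binary.Permutation.Propositional using (_↭_; ↭-refl; ↭-sym; ↭⇒↭ₛ)
open import Data.List.Relation.Binary.Permutation.Propositional.Properties
  using (All-resp-↭; ++⁺; map⁺; shift; ↭-reverse)
open import Relation.Binary.PropositionalEquality
  using (_≡_; _≢_; refl; sym; trans; cong; cong₂; subst; setoid; module ≡-Reasoning)
open import Data.List.Relation.Binary.Permutation.Setoid.Properties (setoid ℕ)
  using (Unique-resp-↭)
open import Data.Product using (_×_; _,_; proj₂; uncurry)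
open import Data.Empty using (⊥-elim)
open import Data.Maybe using (just; nothing)
open import Data.Unit using (⊤)
open import Function using (_∘_)
open import Relation.Binary using (tri<; tri≈; tri>)
open import Relation.Nullary using (yes; no)

<⇒<ᵇ≡true : ∀ {m n} → m < n → (m <ᵇ n) ≡ true
<⇒<ᵇ≡true {zero}  {suc n} _         = refl
<⇒<ᵇ≡true {suc m} {suc n} (s≤s m<n) = <⇒<ᵇ≡true m<n

≥⇒<ᵇ≡false : ∀ {m n} → n ≤ m → (m <ᵇ n) ≡ false
≥⇒<ᵇ≡false {m}     {zero}  _         = refl
≥⇒<ᵇ≡false {suc m} {suc n} (s≤s n≤m) = ≥⇒<ᵇ≡false n≤m

anyᵇ-false : ∀ {p : ℕ → Bool} {xs} → All (λ x → p x ≡ false) xs → anyᵇ p xs ≡ false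
anyᵇ-false []         = refl
anyᵇ-false (px ∷ pxs) rewrite px = anyᵇ-false pxs

anyᵇ-true : ∀ {p : ℕ → Bool} {xs} → Any (λ x → p x ≡ true) xs → anyᵇ p xs ≡ true
anyᵇ-true (here px) rewrite px = refl
anyᵇ-true {p} {x ∷ xs} (there pxs) rewrite anyᵇ-true pxs = ∨-zeroʳ (p x)

sum-map-++ : ∀ {A : Set} (c : A → ℕ) xs ys → sum (map c (xs ++ ys)) ≡ sum (map c xs) + sum (map c ys)
sum-map-++ c xs ys = trans (cong sum (map-++ c xs ys)) (sum-++ (map c xs) (map c ys))

sum-map-↭ : ∀ (c : ℕ → ℕ) {xs ys} → xs ↭ ys → sum (map c xs) ≡ sum (map c ys)
sum-map-↭ c xs↭ys = sum-↭ (map⁺ c xs↭ys)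

sum-map-cong : ∀ {c d : ℕ → ℕ} {xs} → All (λ x → c x ≡ d x) xs → sum (map c xs) ≡ sum (map d xs)
sum-map-cong c≡d = cong sum (map-cong-local c≡d)

sum-map-zero : ∀ {c : ℕ → ℕ} {xs} → All (λ x → c x ≡ 0) xs → sum (map c xs) ≡ 0
sum-map-zero []         = refl
sum-map-zero (cx≡0 ∷ z) = cong₂ _+_ cx≡0 (sum-map-zero z)

sum-map-+ : ∀ (c d : ℕ → ℕ) xs → sum (map (λ x → c x + d x) xs) ≡ sum (map c xs) + sum (map d xs)
sum-map-+ c d []       = refl
sum-map-+ c d (x ∷ xs) = trans (cong (c x + d x +_) (sum-map-+ c d xs)) (interchange (c x) (d x) _ _)

-- Sums over the pairs of a word

pairSum : (ℕ → ℕ → ℕ) → List ℕ → ℕ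
pairSum f []       = 0
pairSum f (x ∷ xs) = sum (map (f x) xs) + pairSum f xs

crossSum : (ℕ → ℕ → ℕ) → List ℕ → List ℕ → ℕ
crossSum f xs ys = sum (map (λ x → sum (map (f x) ys)) xs)

sum-orderedPairs : ∀ f xs → sum (map (uncurry f) (orderedPairs xs)) ≡ pairSum f xs
sum-orderedPairs f []       = refl
sum-orderedPairs f (x ∷ xs) = begin
  sum (map (uncurry f) (map (x ,_) xs ++ orderedPairs xs))
    ≡⟨ sum-map-++ (uncurry f) (map (x ,_) xs) (orderedPairs xs) ⟩
  sum (map (uncurry f) (map (x ,_) xs)) + sum (map (uncurry f) (orderedPairs xs))
    ≡⟨ cong₂ _+_ (cong sum (sym (map-∘ xs))) (sum-orderedPairs f xs) ⟩
  sum (map (f x) xs) + pairSum f xs ∎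
  where open ≡-Reasoning

crossSum-↭ : ∀ f {xs xs′ ys ys′} → xs ↭ xs′ → ys ↭ ys′ → crossSum f xs ys ≡ crossSum f xs′ ys′
crossSum-↭ f {xs′ = xs′} xs↭xs′ ys↭ys′ =
  trans (sum-map-↭ _ xs↭xs′) (cong sum (map-cong (λ x → sum-map-↭ (f x) ys↭ys′) xs′))

pairSum-++ : ∀ f xs ys → pairSum f (xs ++ ys) ≡ pairSum f xs + pairSum f ys + crossSum f xs ys
pairSum-++ f []       ys = sym (+-identityʳ (pairSum f ys))
pairSum-++ f (x ∷ xs) ys = begin
  sum (map (f x) (xs ++ ys)) + pairSum f (xs ++ ys)
    ≡⟨ cong₂ _+_ (sum-map-++ (f x) xs ys) (pairSum-++ f xs ys) ⟩
  sum (map (f x) xs) + sum (map (f x) ys) + (pairSum f xs + pairSum f ys + crossSum f xs ys)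
    ≡⟨ rearrange (sum (map (f x) xs)) (sum (map (f x) ys)) (pairSum f xs) (pairSum f ys) (crossSum f xs ys) ⟩
  sum (map (f x) xs) + pairSum f xs + pairSum f ys + (sum (map (f x) ys) + crossSum f xs ys) ∎
  where
  open ≡-Reasoning
  rearrange : ∀ a b p q k → a + b + (p + q + k) ≡ a + p + q + (b + k)
  rearrange = solve-∀

-- Moving x from the front of M to its back destroys the pairs (x , m) and creates the pairs (m , x).
pairSum-shift : ∀ f x M R →
  pairSum f (x ∷ M ++ R) + sum (map (λ m → f m x) M) ≡ pairSum f (M ++ x ∷ R) + sum (map (f x) M)
pairSum-shift f x M R = begin
  sum (map (f x) (M ++ R)) + pairSum f (M ++ R) + s
    ≡⟨ cong₂ (λ a b → a + b + s) (sum-map-++ (f x) M R) (pairSum-++ f M R) ⟩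
  sum (map (f x) M) + sum (map (f x) R) + (pairSum f M + pairSum f R + crossSum f M R) + s
    ≡⟨ rearrange (sum (map (f x) M)) (sum (map (f x) R)) (pairSum f M) (pairSum f R) (crossSum f M R) s ⟩
  pairSum f M + (sum (map (f x) R) + pairSum f R) + (s + crossSum f M R) + sum (map (f x) M)
    ≡⟨ cong (λ k → pairSum f M + pairSum f (x ∷ R) + k + sum (map (f x) M))
            (sym (sum-map-+ (λ m → f m x) (λ m → sum (map (f m) R)) M)) ⟩
  pairSum f M + pairSum f (x ∷ R) + crossSum f M (x ∷ R) + sum (map (f x) M)
    ≡⟨ cong (_+ sum (map (f x) M)) (sym (pairSum-++ f M (x ∷ R))) ⟩
  pairSum f (M ++ x ∷ R) + sum (map (f x) M) ∎
  where
  open ≡-Reasoning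
  s = sum (map (λ m → f m x) M)
  rearrange : ∀ a b p q k s → a + b + (p + q + k) + s ≡ p + (b + q) + (s + k) + a
  rearrange = solve-∀

Shifted : (ℕ → ℕ → ℕ) → (ℕ → ℕ) → List ℕ → List ℕ → Set
Shifted f c xs ys = xs ↭ ys × pairSum f xs ≡ pairSum f ys + sum (map c ys)

Shifted-refl : ∀ {f c ys} → All (λ y → c y ≡ 0) ys → Shifted f c ys ys
Shifted-refl {f} {c} {ys} c≡0 =
  ↭-refl , sym (trans (cong (pairSum f ys +_) (sum-map-zero c≡0)) (+-identityʳ _))

Shifted-++ : ∀ {f c xs ys xs′ ys′} → Shifted f c xs ys → Shifted f c xs′ ys′ →
             Shifted f c (xs ++ xs′) (ys ++ ys′)
Shifted-++ {f} {c} {xs} {ys} {xs′} {ys′} (xs↭ys , e) (xs′↭ys′ , e′) = ++⁺ xs↭ys xs′↭ys′ , (begin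
  pairSum f (xs ++ xs′)
    ≡⟨ pairSum-++ f xs xs′ ⟩
  pairSum f xs + pairSum f xs′ + crossSum f xs xs′
    ≡⟨ cong₂ _+_ (cong₂ _+_ e e′) (crossSum-↭ f xs↭ys xs′↭ys′) ⟩
  pairSum f ys + sum (map c ys) + (pairSum f ys′ + sum (map c ys′)) + crossSum f ys ys′
    ≡⟨ rearrange (pairSum f ys) (sum (map c ys)) (pairSum f ys′) (sum (map c ys′)) (crossSum f ys ys′) ⟩
  pairSum f ys + pairSum f ys′ + crossSum f ys ys′ + (sum (map c ys) + sum (map c ys′))
    ≡⟨ cong₂ _+_ (sym (pairSum-++ f ys ys′)) (sym (sum-map-++ c ys ys′)) ⟩
  pairSum f (ys ++ ys′) + sum (map c (ys ++ ys′)) ∎)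
  where
  open ≡-Reasoning
  rearrange : ∀ p s p′ s′ k → p + s + (p′ + s′) + k ≡ p + p′ + k + (s + s′)
  rearrange = solve-∀

Shifted-shift : ∀ {f c} x M R → All (λ m → f m x ≡ 0) M → All (λ m → f x m ≡ c m) M →
                All (λ y → c y ≡ 0) (x ∷ R) → Shifted f c (x ∷ M ++ R) (M ++ x ∷ R)
Shifted-shift {f} {c} x M R fmx≡0 fxm≡cm c≡0 = ↭-sym (shift x M R) , (begin
  pairSum f (x ∷ M ++ R)
    ≡⟨ sym (+-identityʳ _) ⟩
  pairSum f (x ∷ M ++ R) + 0
    ≡⟨ cong (pairSum f (x ∷ M ++ R) +_) (sym (sum-map-zero fmx≡0)) ⟩
  pairSum f (x ∷ M ++ R) + sum (map (λ m → f m x) M)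
    ≡⟨ pairSum-shift f x M R ⟩
  pairSum f (M ++ x ∷ R) + sum (map (f x) M)
    ≡⟨ cong (pairSum f (M ++ x ∷ R) +_) (sum-map-cong fxm≡cm) ⟩
  pairSum f (M ++ x ∷ R) + sum (map c M)
    ≡⟨ cong (pairSum f (M ++ x ∷ R) +_) (sym sum-c) ⟩
  pairSum f (M ++ x ∷ R) + sum (map c (M ++ x ∷ R)) ∎)
  where
  open ≡-Reasoning
  sum-c : sum (map c (M ++ x ∷ R)) ≡ sum (map c M)
  sum-c = trans (sum-map-++ c M (x ∷ R)) (trans (cong (sum (map c M) +_) (sum-map-zero c≡0)) (+-identityʳ _))

-- The exponents of φ

rowWeight : ℕ → ℕ → ℕ → ℕ
rowWeight i t r = if r <ᵇ t then (if r ≡ᵇ i then 1 else 0) else 0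

colWeight : ℕ → ℕ → ℕ → ℕ
colWeight i c d = if c <ᵇ d then (if d ≡ᵇ i then 1 else 0) else 0

countSnd-selRow : ∀ i ps → countSnd i (selRow ps) ≡ sum (map (uncurry (rowWeight i)) ps)
countSnd-selRow i []             = refl
countSnd-selRow i ((t , r) ∷ ps) with r <ᵇ t
... | false = countSnd-selRow i ps
... | true with r ≡ᵇ i
...   | true  = cong suc (countSnd-selRow i ps)
...   | false = countSnd-selRow i ps

countFst-selCol : ∀ i ps → countFst i (selCol ps) ≡ sum (map (uncurry (colWeight i)) ps)
countFst-selCol i []             = refl
countFst-selCol i ((c , d) ∷ ps) with c <ᵇ d
... | false = countFst-selCol i ps
... | true with d ≡ᵇ i
...   | true  = cong suc (countFst-selCol i ps)
...   | false = countFst-selCol i ps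

yExp-φ : ∀ row colUp i → yExp (φ row colUp) i ≡ pairSum (rowWeight i) row
yExp-φ row colUp i = trans (countSnd-selRow i (orderedPairs row)) (sum-orderedPairs (rowWeight i) row)

xExp-φ : ∀ row colUp i → xExp (φ row colUp) i ≡ pairSum (colWeight i) (column1 row colUp)
xExp-φ row colUp i =
  trans (countFst-selCol i (orderedPairs (column1 row colUp))) (sum-orderedPairs (colWeight i) (column1 row colUp))

rowWeight-zero : ∀ i {t r} → t ≤ r → rowWeight i t r ≡ 0
rowWeight-zero i t≤r rewrite ≥⇒<ᵇ≡false t≤r = refl

rowWeight-indep : ∀ i {t t′ r} → r < t → r < t′ → rowWeight i t r ≡ rowWeight i t′ r
rowWeight-indep i r<t r<t′ rewrite <⇒<ᵇ≡true r<t | <⇒<ᵇ≡true r<t′ = refl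

colWeight-zero : ∀ i {c d} → d ≤ c → colWeight i c d ≡ 0
colWeight-zero i d≤c rewrite ≥⇒<ᵇ≡false d≤c = refl

colWeight-indep : ∀ i {c c′ d} → c < d → c′ < d → colWeight i c d ≡ colWeight i c′ d
colWeight-indep i c<d c′<d rewrite <⇒<ᵇ≡true c<d | <⇒<ᵇ≡true c′<d = refl

reverse-∷-++ : ∀ (x : ℕ) xs ys → reverse (x ∷ xs) ++ ys ≡ reverse xs ++ x ∷ ys
reverse-∷-++ x xs ys = trans (cong (_++ ys) (unfold-reverse x xs)) (∷ʳ-++ (reverse xs) x ys)

reverse-∷≢[] : ∀ (x : ℕ) xs → reverse (x ∷ xs) ≢ []
reverse-∷≢[] x xs eq with () ← ++-conicalʳ (reverse xs) [ x ] (trans (sym (unfold-reverse x xs)) eq)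

All-reverse : ∀ {P : ℕ → Set} {xs} → All P xs → All P (reverse xs)
All-reverse {xs = xs} = All-resp-↭ (↭-sym (↭-reverse xs))

moveFirstToFront-++ : ∀ {p : ℕ → Bool} L {g} R → All (λ x → p x ≡ false) L → p g ≡ true →
                      moveFirstToFront p (L ++ g ∷ R) ≡ g ∷ L ++ R
moveFirstToFront-++ []      R []         pg rewrite pg = refl
moveFirstToFront-++ (x ∷ L) R (px ∷ pL) pg rewrite px | moveFirstToFront-++ L R pL pg | pg = refl

concatL-splitBefore : ∀ acc fs → concatL (splitBefore acc fs) ≡ reverse acc ++ map proj₂ fs
concatL-splitBefore acc []                 = refl
concatL-splitBefore acc ((true  , x) ∷ fs) = cong (reverse acc ++_) (concatL-splitBefore [ x ] fs)
concatL-splitBefore acc ((false , x) ∷ fs) =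
  trans (concatL-splitBefore (x ∷ acc) fs) (reverse-∷-++ x acc (map proj₂ fs))

concatL-splitAfter : ∀ acc fs → concatL (splitAfter acc fs) ≡ reverse acc ++ map proj₂ fs
concatL-splitAfter acc []                 = refl
concatL-splitAfter acc ((true  , x) ∷ fs) =
  trans (cong (reverse (x ∷ acc) ++_) (concatL-splitAfter [] fs)) (reverse-∷-++ x acc (map proj₂ fs))
concatL-splitAfter acc ((false , x) ∷ fs) =
  trans (concatL-splitAfter (x ∷ acc) fs) (reverse-∷-++ x acc (map proj₂ fs))

letters-armFlags : ∀ u prev w → map proj₂ (armFlags u prev w) ≡ w
letters-armFlags u prev     []      = refl
letters-armFlags u nothing  (x ∷ w) = cong (x ∷_) (letters-armFlags u (just x) w)
letters-armFlags u (just p) (x ∷ w) = cong (x ∷_) (letters-armFlags u (just x) w)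

letters-legFlags : ∀ v w → map proj₂ (legFlags v w) ≡ w
letters-legFlags v []           = refl
letters-legFlags v (x ∷ [])     = refl
letters-legFlags v (x ∷ y ∷ ys) = cong (x ∷_) (letters-legFlags v (y ∷ ys))

firstAbove-∷ : ∀ {u x} xs → u < x → firstAbove u (x ∷ xs) ≡ x
firstAbove-∷ xs u<x rewrite <⇒<ᵇ≡true u<x = refl

firstAbove-++ : ∀ {u} L R → All (_< u) L → firstAbove u (L ++ R) ≡ firstAbove u R
firstAbove-++ []      R []             = refl
firstAbove-++ (x ∷ L) R (x<u ∷ L<u) rewrite ≥⇒<ᵇ≡false (<⇒≤ x<u) = firstAbove-++ L R L<u

firstAbove-self : ∀ u w → firstAbove u (u ∷ w) ≡ firstAbove u w
firstAbove-self u w rewrite ≥⇒<ᵇ≡false (≤-refl {u}) = refl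

firstAbove-above : ∀ {u w} → Any (u <_) w → u < firstAbove u w
firstAbove-above {u} {x ∷ w} (here u<x) rewrite <⇒<ᵇ≡true u<x = u<x
firstAbove-above {u} {x ∷ w} (there a) with u <? x
... | yes u<x rewrite <⇒<ᵇ≡true u<x = u<x
... | no  u≮x rewrite ≥⇒<ᵇ≡false (≮⇒≥ u≮x) = firstAbove-above a

firstAbove-∈ : ∀ {u w} → Any (u <_) w → firstAbove u w ∈ w
firstAbove-∈ {u} {x ∷ w} (here u<x) rewrite <⇒<ᵇ≡true u<x = here refl
firstAbove-∈ {u} {x ∷ w} (there a) with u <? x
... | yes u<x rewrite <⇒<ᵇ≡true u<x = here refl
... | no  u≮x rewrite ≥⇒<ᵇ≡false (≮⇒≥ u≮x) = there (firstAbove-∈ a)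

lastD-∈ : ∀ (x : ℕ) xs → lastD (x ∷ xs) ∈ x ∷ xs
lastD-∈ x []       = here refl
lastD-∈ x (y ∷ ys) = there (lastD-∈ y ys)

lastD-above⇒Any : ∀ {u} w → u < lastD (u ∷ w) → Any (u <_) w
lastD-above⇒Any {u} w end with lose (lastD-∈ u w) end
... | here u<u = ⊥-elim (<-irrefl refl u<u)
... | there a  = a

take-1-headD : ∀ {x} xs → headD xs ≡ x → 0 < x → take 1 xs ≡ [ x ]
take-1-headD []      refl ()
take-1-headD (_ ∷ _) refl _ = refl

oneTo-unique : ∀ n → Unique (oneTo n)
oneTo-unique n = Unique.map⁺ suc-injective (upTo⁺ n)

Unique-++⇒≢ : ∀ {x : ℕ} xs {ys} → Unique (xs ++ ys) → x ∈ xs → All (x ≢_) ys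
Unique-++⇒≢ (_ ∷ xs) (x∉ ∷ _) (here refl) = ++⁻ʳ xs x∉
Unique-++⇒≢ (_ ∷ xs) (_ ∷ u)  (there x∈)  = Unique-++⇒≢ xs u x∈

-- The blocks of arm

data ArmBlock (u : ℕ) : List ℕ → Set where
  above      : ∀ {B} → All (u <_) B → ArmBlock u B
  belowAbove : ∀ {L G} → All (_< u) L → L ≢ [] → All (u <_) G → G ≢ [] → ArmBlock u (L ++ G)

armBlocks : ℕ → List ℕ → List (List ℕ)
armBlocks u w = splitBefore [] (armFlags u nothing w)

concatL-armBlocks : ∀ u w → concatL (armBlocks u w) ≡ w
concatL-armBlocks u w = trans (concatL-splitBefore [] (armFlags u nothing w)) (letters-armFlags u nothing w)

-- The current block is reverse (p ∷ rest), p being the previous letter.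
data ArmState (u : ℕ) : ℕ → List ℕ → Set where
  above      : ∀ {p rest} → All (u <_) (p ∷ rest) → ArmState u p rest
  below      : ∀ {p rest} → All (_< u) (p ∷ rest) → ArmState u p rest
  belowAbove : ∀ {p G l L} → All (u <_) (p ∷ G) → All (_< u) (l ∷ L) → ArmState u p (G ++ l ∷ L)

closeArmBlock : ∀ {u p rest} → ArmState u p rest → u < p → ArmBlock u (reverse (p ∷ rest))
closeArmBlock (above a)           _   = above (All-reverse a)
closeArmBlock (below (p<u ∷ _))   u<p = ⊥-elim (<-asym p<u u<p)
closeArmBlock {u} (belowAbove {p} {G} {l} {L} a b) _ =
  subst (ArmBlock u) (sym (reverse-++ (p ∷ G) (l ∷ L)))
    (belowAbove (All-reverse b) (reverse-∷≢[] l L) (All-reverse a) (reverse-∷≢[] p G))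

ArmState-∷above : ∀ {u p rest x} → u < x → ArmState u p rest → ArmState u x (p ∷ rest)
ArmState-∷above u<x (above a)                = above (u<x ∷ a)
ArmState-∷above u<x (below b)                = belowAbove {G = []} (u<x ∷ []) b
ArmState-∷above u<x (belowAbove {p} {G} a b) = belowAbove {G = p ∷ G} (u<x ∷ a) b

armBlocksFrom : ∀ {u p rest} xs → ArmState u p rest → All (u ≢_) xs → u < lastD (p ∷ xs) →
                All (ArmBlock u) (splitBefore (p ∷ rest) (armFlags u (just p) xs))
armBlocksFrom []           st _ u<p = closeArmBlock st u<p ∷ []
armBlocksFrom {u} (x ∷ xs) st (u≢x ∷ u≢xs) end with <-cmp u x
... | tri≈ _ u≡x _ = ⊥-elim (u≢x u≡x)
... | tri< u<x _ _ rewrite ≥⇒<ᵇ≡false (<⇒≤ u<x) = armBlocksFrom xs (ArmState-∷above u<x st) u≢xs end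
... | tri> _ _ x<u rewrite <⇒<ᵇ≡true x<u with st
...   | below b@(p<u ∷ _) rewrite ≥⇒<ᵇ≡false (<⇒≤ p<u) = armBlocksFrom xs (below (x<u ∷ b)) u≢xs end
...   | above (u<p ∷ a) rewrite <⇒<ᵇ≡true u<p =
        closeArmBlock st u<p ∷ armBlocksFrom xs (below (x<u ∷ [])) u≢xs end
...   | belowAbove (u<p ∷ a) b rewrite <⇒<ᵇ≡true u<p =
        closeArmBlock st u<p ∷ armBlocksFrom xs (below (x<u ∷ [])) u≢xs end

armBlocks-ArmBlock : ∀ u w → All (u ≢_) w → u < lastD (u ∷ w) → All (ArmBlock u) (armBlocks u w)
armBlocks-ArmBlock u []      _            u<u = ⊥-elim (<-irrefl refl u<u)
armBlocks-ArmBlock u (x ∷ w) (u≢x ∷ u≢w) end with <-cmp u x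
... | tri≈ _ u≡x _ = ⊥-elim (u≢x u≡x)
... | tri< u<x _ _ rewrite ≥⇒<ᵇ≡false (<⇒≤ u<x) = armBlocksFrom w (above (u<x ∷ [])) u≢w end
... | tri> _ _ x<u rewrite <⇒<ᵇ≡true x<u = above [] ∷ armBlocksFrom w (below (x<u ∷ [])) u≢w end

armBlock-above : ∀ {u B} → All (u <_) B → armBlock u B ≡ B
armBlock-above u<B rewrite anyᵇ-false (All.map (≥⇒<ᵇ≡false ∘ <⇒≤) u<B) = refl

armBlock-belowAbove : ∀ {u l} L {g} G → All (_< u) (l ∷ L) → u < g →
                      armBlock u (l ∷ L ++ g ∷ G) ≡ g ∷ l ∷ L ++ G
armBlock-belowAbove L G L<u@(l<u ∷ _) u<g rewrite <⇒<ᵇ≡true l<u =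
  moveFirstToFront-++ (_ ∷ L) G (All.map (≥⇒<ᵇ≡false ∘ <⇒≤) L<u) (<⇒<ᵇ≡true u<g)

armBlock-shifted : ∀ i {u B} → ArmBlock u B → Shifted (rowWeight i) (rowWeight i u) (armBlock u B) B
armBlock-shifted i (above u<B) rewrite armBlock-above u<B =
  Shifted-refl (All.map (rowWeight-zero i ∘ <⇒≤) u<B)
armBlock-shifted i (belowAbove {[]} _ L≢[] _ _)         = ⊥-elim (L≢[] refl)
armBlock-shifted i (belowAbove {_ ∷ _} {[]} _ _ _ G≢[]) = ⊥-elim (G≢[] refl)
armBlock-shifted i (belowAbove {l ∷ L} {g ∷ G} L<u _ G>u@(u<g ∷ _) _)
  rewrite armBlock-belowAbove L G L<u u<g =
  Shifted-shift g (l ∷ L) G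
    (All.map (λ m<u → rowWeight-zero i (<⇒≤ (<-trans m<u u<g))) L<u)
    (All.map (λ m<u → rowWeight-indep i (<-trans m<u u<g) m<u) L<u)
    (All.map (rowWeight-zero i ∘ <⇒≤) G>u)

armBlocks-shifted : ∀ i {u} Bs → All (ArmBlock u) Bs →
                    Shifted (rowWeight i) (rowWeight i u) (concatL (map (armBlock u) Bs)) (concatL Bs)
armBlocks-shifted i {u} []       []       = Shifted-refl {f = rowWeight i} {c = rowWeight i u} []
armBlocks-shifted i     (B ∷ Bs) (b ∷ bs) = Shifted-++ (armBlock-shifted i b) (armBlocks-shifted i Bs bs)

headD-armBlocks : ∀ {u} Bs → All (ArmBlock u) Bs →
                  headD (concatL (map (armBlock u) Bs)) ≡ firstAbove u (concatL Bs)
headD-armBlocks []       []              = refl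
headD-armBlocks (_ ∷ Bs) (above [] ∷ bs) = headD-armBlocks Bs bs
headD-armBlocks (_ ∷ Bs) (above {_ ∷ B} u<B@(u<x ∷ _) ∷ bs)
  rewrite armBlock-above u<B = sym (firstAbove-∷ (B ++ concatL Bs) u<x)
headD-armBlocks (_ ∷ Bs) (belowAbove {[]} _ L≢[] _ _ ∷ _)         = ⊥-elim (L≢[] refl)
headD-armBlocks (_ ∷ Bs) (belowAbove {_ ∷ _} {[]} _ _ _ G≢[] ∷ _) = ⊥-elim (G≢[] refl)
headD-armBlocks {u} (_ ∷ Bs) (belowAbove {l ∷ L} {g ∷ G} L<u _ (u<g ∷ _) _ ∷ _)
  rewrite armBlock-belowAbove L G L<u u<g = sym (begin
    firstAbove u (((l ∷ L) ++ g ∷ G) ++ R) ≡⟨ cong (firstAbove u) (++-assoc (l ∷ L) (g ∷ G) R) ⟩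
    firstAbove u ((l ∷ L) ++ g ∷ G ++ R)   ≡⟨ firstAbove-++ (l ∷ L) (g ∷ G ++ R) L<u ⟩
    firstAbove u (g ∷ G ++ R)              ≡⟨ firstAbove-∷ (G ++ R) u<g ⟩
    g                                      ∎)
  where
  open ≡-Reasoning
  R = concatL Bs

arm-shifted : ∀ i u w → All (u ≢_) w → u < lastD (u ∷ w) →
              Shifted (rowWeight i) (rowWeight i u) (arm u w) w
arm-shifted i u w u≢w end =
  subst (Shifted (rowWeight i) (rowWeight i u) (arm u w)) (concatL-armBlocks u w)
    (armBlocks-shifted i (armBlocks u w) (armBlocks-ArmBlock u w u≢w end))

headD-arm : ∀ u w → All (u ≢_) w → u < lastD (u ∷ w) → headD (arm u w) ≡ firstAbove u w
headD-arm u w u≢w end =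
  trans (headD-armBlocks (armBlocks u w) (armBlocks-ArmBlock u w u≢w end))
        (cong (firstAbove u) (concatL-armBlocks u w))

pairSum-arm : ∀ i u w → All (u ≢_) w → u < lastD (u ∷ w) →
              pairSum (rowWeight i) (u ∷ w) ≡ pairSum (rowWeight i) (arm u w)
pairSum-arm i u w u≢w end =
  trans (+-comm (sum (map (rowWeight i u) w)) (pairSum (rowWeight i) w)) (sym (proj₂ (arm-shifted i u w u≢w end)))

-- The blocks of leg

data LegBlock (v : ℕ) : List ℕ → Set where
  below      : ∀ {B} → All (_< v) B → LegBlock v B
  belowAbove : ∀ {L l G} → All (_< v) L → l < v → All (v <_) G → G ≢ [] → LegBlock v (L ++ l ∷ G)

legBlocks : ℕ → List ℕ → List (List ℕ)
legBlocks v w = splitAfter [] (legFlags v w)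

concatL-legBlocks : ∀ v w → concatL (legBlocks v w) ≡ w
concatL-legBlocks v w = trans (concatL-splitAfter [] (legFlags v w)) (letters-legFlags v w)

HeadBelow : ℕ → List ℕ → Set
HeadBelow v []      = ⊤
HeadBelow v (x ∷ _) = x < v

-- The current block is reverse acc and xs are the unread letters; since legFlags looks one
-- letter ahead, the states record what is known about the next letter.
data LegState (v : ℕ) : List ℕ → List ℕ → Set where
  empty      : ∀ {xs} → HeadBelow v xs → LegState v [] xs
  below      : ∀ {a acc xs} → All (_< v) (a ∷ acc) → LegState v (a ∷ acc) xs
  belowAbove : ∀ {g G l L y ys} → All (v <_) (g ∷ G) → All (_< v) (l ∷ L) → v < y →
               LegState v (g ∷ G ++ l ∷ L) (y ∷ ys)

closeLegBlock : ∀ {v x acc xs} → v < x → LegState v acc (x ∷ xs) → LegBlock v (reverse (x ∷ acc))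
closeLegBlock v<x (empty x<v) = ⊥-elim (<-asym v<x x<v)
closeLegBlock {v} v<x (below {a} {acc} (a<v ∷ acc<v)) =
  subst (LegBlock v) (sym (ʳ++-defn acc)) (belowAbove (All-reverse acc<v) a<v (v<x ∷ []) λ ())
closeLegBlock {v} {x} v<x (belowAbove {g} {G} {l} {L} G>v (l<v ∷ L<v) _) =
  subst (LegBlock v) (sym (trans (reverse-++ (x ∷ g ∷ G) (l ∷ L)) (reverse-∷-++ l L _)))
    (belowAbove (All-reverse L<v) l<v (All-reverse (v<x ∷ G>v)) (reverse-∷≢[] x (g ∷ G)))

LegState-below : ∀ {v x acc xs} → x < v → LegState v acc (x ∷ xs) → All (_< v) acc
LegState-below x<v (empty _)            = []
LegState-below x<v (below acc<v)        = acc<v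
LegState-below x<v (belowAbove _ _ v<x) = ⊥-elim (<-asym v<x x<v)

LegState-∷below : ∀ {v x acc xs} → x < v → LegState v acc (x ∷ xs) → LegState v (x ∷ acc) xs
LegState-∷below x<v st = below (x<v ∷ LegState-below x<v st)

LegState-∷above : ∀ {v x y acc ys} → v < x → v < y → LegState v acc (x ∷ y ∷ ys) →
                  LegState v (x ∷ acc) (y ∷ ys)
LegState-∷above v<x v<y (empty x<v)                = ⊥-elim (<-asym v<x x<v)
LegState-∷above v<x v<y (below b)                  = belowAbove {G = []} (v<x ∷ []) b v<y
LegState-∷above v<x v<y (belowAbove {g} {G} a b _) = belowAbove {G = g ∷ G} (v<x ∷ a) b v<y

LegBlocksFrom : ℕ → List ℕ → Set
LegBlocksFrom v xs =
  ∀ {acc} → LegState v acc xs → All (v ≢_) xs → All (LegBlock v) (splitAfter acc (legFlags v xs))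

legBlocksFrom-[] : ∀ {v} → LegBlocksFrom v []
legBlocksFrom-[] (empty _) _ = below [] ∷ []
legBlocksFrom-[] (below b) _ = below (All-reverse b) ∷ []

legBlocksFrom-∷ : ∀ {v} x xs → LegBlocksFrom v xs → LegBlocksFrom v (x ∷ xs)
legBlocksFrom-∷ {v} x [] _ st (v≢x ∷ _) with <-cmp v x
... | tri≈ _ v≡x _ = ⊥-elim (v≢x v≡x)
... | tri< v<x _ _ rewrite <⇒<ᵇ≡true v<x = closeLegBlock v<x st ∷ below [] ∷ []
... | tri> _ _ x<v rewrite ≥⇒<ᵇ≡false (<⇒≤ x<v) =
  below (All-reverse (x<v ∷ LegState-below x<v st)) ∷ []
legBlocksFrom-∷ {v} x (y ∷ ys) split st (v≢x ∷ v≢y∷ys@(v≢y ∷ _)) with <-cmp v x | <-cmp v y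
... | tri≈ _ v≡x _ | _ = ⊥-elim (v≢x v≡x)
... | tri> _ _ x<v | _ rewrite ≥⇒<ᵇ≡false (<⇒≤ x<v) = split (LegState-∷below x<v st) v≢y∷ys
... | tri< v<x _ _ | tri≈ _ v≡y _ = ⊥-elim (v≢y v≡y)
... | tri< v<x _ _ | tri> _ _ y<v rewrite <⇒<ᵇ≡true v<x | <⇒<ᵇ≡true y<v =
  closeLegBlock v<x st ∷ split (empty y<v) v≢y∷ys
... | tri< v<x _ _ | tri< v<y _ _ rewrite <⇒<ᵇ≡true v<x | ≥⇒<ᵇ≡false (<⇒≤ v<y) =
  split (LegState-∷above v<x v<y st) v≢y∷ys

legBlocksFrom : ∀ {v} xs → LegBlocksFrom v xs
legBlocksFrom []       = legBlocksFrom-[]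
legBlocksFrom (x ∷ xs) = legBlocksFrom-∷ x xs (legBlocksFrom xs)

legBlock-below : ∀ {v B} → All (_< v) B → legBlock v B ≡ B
legBlock-below B<v rewrite anyᵇ-false (All.map (≥⇒<ᵇ≡false ∘ <⇒≤) B<v) = refl

legBlock-belowAbove : ∀ {v l g} L G → l < v → All (v <_) (g ∷ G) →
                      legBlock v (L ++ l ∷ g ∷ G) ≡ L ++ (g ∷ G) ++ [ l ]
legBlock-belowAbove {v} {l} {g} L G l<v G>v@(v<g ∷ _) = begin
  legBlock v (L ++ l ∷ g ∷ G)
    ≡⟨ cong (if_then moveLastToEnd (_<ᵇ v) (L ++ l ∷ g ∷ G) else L ++ l ∷ g ∷ G)
            (anyᵇ-true (++⁺ʳ L (there (here (<⇒<ᵇ≡true v<g))))) ⟩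
  reverse (moveFirstToFront (_<ᵇ v) (reverse (L ++ l ∷ g ∷ G)))
    ≡⟨ cong (reverse ∘ moveFirstToFront (_<ᵇ v))
            (trans (reverse-++ L (l ∷ g ∷ G)) (reverse-∷-++ l (g ∷ G) (reverse L))) ⟩
  reverse (moveFirstToFront (_<ᵇ v) (reverse (g ∷ G) ++ l ∷ reverse L))
    ≡⟨ cong reverse (moveFirstToFront-++ (reverse (g ∷ G)) (reverse L)
                       (All-reverse (All.map (≥⇒<ᵇ≡false ∘ <⇒≤) G>v)) (<⇒<ᵇ≡true l<v)) ⟩
  reverse (l ∷ reverse (g ∷ G) ++ reverse L)
    ≡⟨ cong (reverse ∘ (l ∷_)) (sym (reverse-++ L (g ∷ G))) ⟩
  reverse (l ∷ reverse (L ++ g ∷ G))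
    ≡⟨ unfold-reverse l (reverse (L ++ g ∷ G)) ⟩
  reverse (reverse (L ++ g ∷ G)) ++ [ l ]
    ≡⟨ cong (_++ [ l ]) (reverse-involutive (L ++ g ∷ G)) ⟩
  (L ++ g ∷ G) ++ [ l ]
    ≡⟨ ++-assoc L (g ∷ G) [ l ] ⟩
  L ++ (g ∷ G) ++ [ l ] ∎
  where open ≡-Reasoning

legBlock-shifted : ∀ i {v B} → LegBlock v B → Shifted (colWeight i) (colWeight i v) B (legBlock v B)
legBlock-shifted i (below B<v) rewrite legBlock-below B<v =
  Shifted-refl (All.map (colWeight-zero i ∘ <⇒≤) B<v)
legBlock-shifted i (belowAbove {G = []} _ _ _ G≢[]) = ⊥-elim (G≢[] refl)
legBlock-shifted i {v} (belowAbove {L} {l} {g ∷ G} L<v l<v G>v _)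
  rewrite legBlock-belowAbove L G l<v G>v =
  Shifted-++ (Shifted-refl (All.map (colWeight-zero i ∘ <⇒≤) L<v))
    (subst (λ ys → Shifted (colWeight i) (colWeight i v) (l ∷ ys) ((g ∷ G) ++ [ l ]))
           (++-identityʳ (g ∷ G))
      (Shifted-shift l (g ∷ G) []
        (All.map (λ v<m → colWeight-zero i (<⇒≤ (<-trans l<v v<m))) G>v)
        (All.map (λ v<m → colWeight-indep i (<-trans l<v v<m) v<m) G>v)
        (colWeight-zero i (<⇒≤ l<v) ∷ [])))

legBlocks-shifted : ∀ i {v} Bs → All (LegBlock v) Bs →
                    Shifted (colWeight i) (colWeight i v) (concatL Bs) (concatL (map (legBlock v) Bs))
legBlocks-shifted i {v} []       []       = Shifted-refl {f = colWeight i} {c = colWeight i v} []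
legBlocks-shifted i     (B ∷ Bs) (b ∷ bs) = Shifted-++ (legBlock-shifted i b) (legBlocks-shifted i Bs bs)

leg-shifted : ∀ i v C → HeadBelow v C → All (v ≢_) C →
              Shifted (colWeight i) (colWeight i v) C (leg v C)
leg-shifted i v C head<v v≢C =
  subst (λ xs → Shifted (colWeight i) (colWeight i v) xs (leg v C)) (concatL-legBlocks v C)
    (legBlocks-shifted i (legBlocks v C) (legBlocksFrom C (empty head<v) v≢C))

pairSum-leg : ∀ i v C → HeadBelow v C → All (v ≢_) C →
              pairSum (colWeight i) C ≡ pairSum (colWeight i) (v ∷ leg v C)
pairSum-leg i v C head<v v≢C =
  trans (proj₂ (leg-shifted i v C head<v v≢C)) (+-comm (pairSum (colWeight i) (leg v C)) _)

θ-preserves-φ : ∀ u w colUp → Unique (u ∷ w ++ colUp) → u < lastD (u ∷ w) →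
                φ (u ∷ w) colUp ≈ₘ φ (θRow (u ∷ w) colUp) (θCol (u ∷ w) colUp)
θ-preserves-φ u w colUp (u∉ ∷ distinct) end i = xExp-≡ , yExp-≡
  where
  open ≡-Reasoning
  v : ℕ
  v = firstAbove u w
  u<v : u < v
  u<v = firstAbove-above (lastD-above⇒Any w end)
  u≢w : All (u ≢_) w
  u≢w = ++⁻ˡ w u∉
  v≢u∷colUp : All (v ≢_) (u ∷ colUp)
  v≢u∷colUp = >⇒≢ u<v ∷ Unique-++⇒≢ w distinct (firstAbove-∈ (lastD-above⇒Any w end))
  corner : take 1 (arm u w) ≡ [ v ]
  corner = take-1-headD (arm u w) (headD-arm u w u≢w end) (≤-<-trans z≤n u<v)
  xExp-≡ : xExp (φ (u ∷ w) colUp) i ≡ xExp (φ (θRow (u ∷ w) colUp) (θCol (u ∷ w) colUp)) i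
  xExp-≡ = begin
    xExp (φ (u ∷ w) colUp) i                       ≡⟨ xExp-φ (u ∷ w) colUp i ⟩
    pairSum (colWeight i) (u ∷ colUp)              ≡⟨ pairSum-leg i v (u ∷ colUp) u<v v≢u∷colUp ⟩
    pairSum (colWeight i) (v ∷ leg v (u ∷ colUp))
      ≡⟨ cong₂ (λ c v′ → pairSum (colWeight i) (c ++ leg v′ (u ∷ colUp)))
               (sym corner) (sym (firstAbove-self u w)) ⟩
    pairSum (colWeight i) (column1 (θRow (u ∷ w) colUp) (θCol (u ∷ w) colUp))
      ≡⟨ sym (xExp-φ (θRow (u ∷ w) colUp) (θCol (u ∷ w) colUp) i) ⟩
    xExp (φ (θRow (u ∷ w) colUp) (θCol (u ∷ w) colUp)) i ∎
  yExp-≡ : yExp (φ (u ∷ w) colUp) i ≡ yExp (φ (θRow (u ∷ w) colUp) (θCol (u ∷ w) colUp)) i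
  yExp-≡ = begin
    yExp (φ (u ∷ w) colUp) i                             ≡⟨ yExp-φ (u ∷ w) colUp i ⟩
    pairSum (rowWeight i) (u ∷ w)                        ≡⟨ pairSum-arm i u w u≢w end ⟩
    pairSum (rowWeight i) (arm u w)                      ≡⟨ sym (yExp-φ (arm u w) (θCol (u ∷ w) colUp) i) ⟩
    yExp (φ (θRow (u ∷ w) colUp) (θCol (u ∷ w) colUp)) i ∎

mainTheorem2 : (a ℓ : ℕ) → 2 ≤ a → 1 ≤ ℓ →
    (row colUp : List ℕ) →
    IsStdHook a (ℓ ∸ 1) row colUp →
    headD row < lastD row →
    φ row colUp ≈ₘ φ (θRow row colUp) (θCol row colUp)
mainTheorem2 _ _ _ _ []      _     _                     ()
mainTheorem2 _ _ _ _ (u ∷ w) colUp (_ , _ , entries↭1…n) end =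
  θ-preserves-φ u w colUp (Unique-resp-↭ (↭⇒↭ₛ (↭-sym entries↭1…n)) (oneTo-unique _)) end
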